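{- Let $G$ be a graph with $\delta(G)\ge k\ge 1$. Then $d_{\times k,t}^{r}(G)=d_{\times k,t}(G)$.
   Context: All graphs are finite and simple; $N(x)$ denotes the open neighborhood of $x$ and $\delta$ the minimum degree. For an integer $k\ge 1$, a set $S\subseteq V(G)$ is a $k$-tuple total dominating set (kTDS) of $G$ if $|N(x)\cap S|\ge k$ for every $x\in V(G)$. A kTDS $S$ is a $k$-tuple total restrained dominating set (kTRDS) if moreover every vertex $x\in V(G)\setminus S$ is adjacent to at least $k$ vertices of $V(G)\setminus S$. $d_{\times k,t}(G)$ (the $k$-tuple total domatic number) is the maximum number of classes of a partition of $V(G)$ all of whose classes are kTDSs, and $d_{\times k,t}^{r}(G)$ (the $k$-tuple total restrained domatic number) is the maximum number of classes of a partition of $V(G)$ all of whose classes are kTRDSs. -}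

module Defs where

open import Data.Nat using (ℕ; _≤_)
open import Data.Bool using (Bool; true; false; _∧_; not)
open import Data.Fin using (Fin; _≟_)
open import Data.List using (List; length; filterᵇ; allFin)
open import Data.Product using (Σ; ∃; _×_)
open import Relation.Nullary.Decidable using (⌊_⌋)
open import Relation.Binary.PropositionalEquality using (_≡_)
open import Function.Definitions using (Surjective)

record Graph : Set where
  field
    n      : ℕ
    adj    : Fin n → Fin n → Bool
    sym    : ∀ x y → adj x y ≡ adj y x
    irrefl : ∀ x → adj x x ≡ false
open Graph public

VSet : Graph → Set
VSet G = Fin (n G) → Bool

nbrCount : (G : Graph) → VSet G → Fin (n G) → ℕ
nbrCount G S x = length (filterᵇ (λ y → adj G x y ∧ S y) (allFin (n G)))

deg : (G : Graph) → Fin (n G) → ℕ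
deg G x = nbrCount G (λ _ → true) x

MinDegGE : Graph → ℕ → Set
MinDegGE G k = ∀ x → k ≤ deg G x

complement : (G : Graph) → VSet G → VSet G
complement G S y = not (S y)

IsKTDS : (G : Graph) → ℕ → VSet G → Set
IsKTDS G k S = ∀ x → k ≤ nbrCount G S x

IsKTRDS : (G : Graph) → ℕ → VSet G → Set
IsKTRDS G k S =
  IsKTDS G k S × (∀ x → S x ≡ false → k ≤ nbrCount G (complement G S) x)

-- A partition of V(G) into m (nonempty) classes, given by a surjective
-- class-assignment map c : V(G) → Fin m; class i is {y | c y = i}.
classOf : (G : Graph) {m : ℕ} → (Fin (n G) → Fin m) → Fin m → VSet G
classOf G c i y = ⌊ c y ≟ i ⌋

HasPartition : (G : Graph) → (VSet G → Set) → ℕ → Set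
HasPartition G P m =
  Σ (Fin (n G) → Fin m) λ c → Surjective _≡_ _≡_ c × (∀ i → P (classOf G c i))

IsMaxPartitionNumber : (G : Graph) → (VSet G → Set) → ℕ → Set
IsMaxPartitionNumber G P d = HasPartition G P d × (∀ m → HasPartition G P m → m ≤ d)

IsKTupleTotalDomatic : Graph → ℕ → ℕ → Set
IsKTupleTotalDomatic G k d = IsMaxPartitionNumber G (IsKTDS G k) d

IsKTupleTotalRestrainedDomatic : Graph → ℕ → ℕ → Set
IsKTupleTotalRestrainedDomatic G k d = IsMaxPartitionNumber G (IsKTRDS G k) d

-- In a partition of V(G) into kTDSs, a vertex x outside a class V_i lies in
-- its own class V_{c(x)}, which is disjoint from V_i; since V_{c(x)} is a kTDS,
-- x has at least k neighbours in V_{c(x)} ⊆ V(G) ∖ V_i. So every kTDS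
-- partition is already a kTRDS partition, and conversely trivially; the two
-- kinds of partition therefore have the same possible sizes and the same maximum.
module Submission where

open import Defs
open import Data.Nat using (ℕ; _≤_)
open import Data.Nat.Properties using (≤-trans)
open import Data.Bool using (Bool; true; false; T; _∧_)
open import Data.Bool.Properties using (T?)
open import Data.Fin using (Fin)
open import Data.List using (length; filterᵇ; allFin)
open import Data.List.Relation.Binary.Sublist.Propositional using (⊆-refl)
open import Data.List.Relation.Binary.Sublist.Propositional.Properties
  using (filter⁺; length-mono-≤)
open import Data.Product using (_×_; _,_; proj₁)
open import Function using (_∘_)
open import Relation.Nullary.Decidable using (toWitness; fromWitness; fromWitnessFalse)
open import Relation.Binary.PropositionalEquality using (_≡_; _≢_; refl; subst)

length-filterᵇ-mono : {A : Set} {p q : A → Bool} → (∀ x → T (p x) → T (q x)) →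
  ∀ xs → length (filterᵇ p xs) ≤ length (filterᵇ q xs)
length-filterᵇ-mono {p = p} {q} p⇒q xs =
  length-mono-≤ (filter⁺ (T? ∘ p) (T? ∘ q) (λ { refl → p⇒q _ }) (⊆-refl {x = xs}))

module _ (G : Graph) where

  _⊆ᵛ_ : VSet G → VSet G → Set
  S ⊆ᵛ S′ = ∀ y → T (S y) → T (S′ y)

  nbrCount-mono : {S S′ : VSet G} → S ⊆ᵛ S′ → ∀ x → nbrCount G S x ≤ nbrCount G S′ x
  nbrCount-mono {S} {S′} S⊆S′ x = length-filterᵇ-mono adj∧S⇒adj∧S′ (allFin (n G))
    where
    adj∧S⇒adj∧S′ : ∀ y → T (adj G x y ∧ S y) → T (adj G x y ∧ S′ y)
    adj∧S⇒adj∧S′ y with adj G x y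
    ... | true  = S⊆S′ y
    ... | false = λ ()

  IsKTDS-mono : ∀ {k} {S S′ : VSet G} → S ⊆ᵛ S′ → IsKTDS G k S → IsKTDS G k S′
  IsKTDS-mono S⊆S′ kS x = ≤-trans (kS x) (nbrCount-mono S⊆S′ x)

  module _ {m : ℕ} (c : Fin (n G) → Fin m) where

    classOf-self : ∀ x → T (classOf G c (c x) x)
    classOf-self x = fromWitness refl

    classOf-⊆-complement : ∀ {i j} → j ≢ i → classOf G c j ⊆ᵛ complement G (classOf G c i)
    classOf-⊆-complement j≢i y y∈j = fromWitnessFalse λ cy≡i → j≢i (subst (_≡ _) (toWitness y∈j) cy≡i)

    classOf-notMember : ∀ {i x} → classOf G c i x ≡ false → c x ≢ i
    classOf-notMember x∉i refl = subst T x∉i (classOf-self _)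

    ktds-classes-are-ktrds : ∀ {k} → (∀ i → IsKTDS G k (classOf G c i)) →
      ∀ i → IsKTRDS G k (classOf G c i)
    ktds-classes-are-ktrds ktds i =
      ktds i , λ x x∉i → IsKTDS-mono (classOf-⊆-complement (classOf-notMember x∉i)) (ktds (c x)) x

  HasPartition-map : (P Q : VSet G → Set) {m : ℕ} → (∀ S → P S → Q S) →
    HasPartition G P m → HasPartition G Q m
  HasPartition-map _ _ P⇒Q (c , surj , classes) = c , surj , λ i → P⇒Q _ (classes i)

  IsMaxPartitionNumber-cong : (P Q : VSet G → Set) →
    (∀ {m} → HasPartition G P m → HasPartition G Q m) →
    (∀ {m} → HasPartition G Q m → HasPartition G P m) →
    ∀ {d} → IsMaxPartitionNumber G P d → IsMaxPartitionNumber G Q d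
  IsMaxPartitionNumber-cong _ _ P→Q Q→P (part , max) = P→Q part , λ m → max m ∘ Q→P

  module _ (k : ℕ) {m : ℕ} where

    ktds-partition⇒ktrds-partition : HasPartition G (IsKTDS G k) m → HasPartition G (IsKTRDS G k) m
    ktds-partition⇒ktrds-partition (c , surj , classes) = c , surj , ktds-classes-are-ktrds c classes

    ktrds-partition⇒ktds-partition : HasPartition G (IsKTRDS G k) m → HasPartition G (IsKTDS G k) m
    ktrds-partition⇒ktds-partition = HasPartition-map (IsKTRDS G k) (IsKTDS G k) (λ _ → proj₁)

-- The degree hypotheses only guarantee that both domatic numbers exist; the
-- equivalence of the two maximality statements holds without them.
theorem4p4 : (G : Graph) (k : ℕ) → 1 ≤ k → MinDegGE G k →
    (∀ d → IsKTupleTotalRestrainedDomatic G k d → IsKTupleTotalDomatic G k d) ×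
    (∀ d → IsKTupleTotalDomatic G k d → IsKTupleTotalRestrainedDomatic G k d)
theorem4p4 G k _ _ =
  (λ _ → IsMaxPartitionNumber-cong G (IsKTRDS G k) (IsKTDS G k)
           (ktrds-partition⇒ktds-partition G k) (ktds-partition⇒ktrds-partition G k)) ,
  (λ _ → IsMaxPartitionNumber-cong G (IsKTDS G k) (IsKTRDS G k)
           (ktds-partition⇒ktrds-partition G k) (ktrds-partition⇒ktds-partition G k))
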